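{- Let $(Y,\mathcal{B})$ be a DTS$(w)$ and $(X,\mathcal{A})$ a DTS$(v)$ with $Y\subseteq X$ and $\mathcal{B}\subseteq\mathcal{A}$. If $(Y,\mathcal{B})$ does not have a $w$-good sequencing, then $(X,\mathcal{A})$ does not have a $v$-good sequencing.
   Context: A transitive triple is an ordered triple $(x,y,z)$ of distinct elements; it contains the directed edges $(x,y)$, $(x,z)$, $(y,z)$. A directed triple system of order $v$, DTS$(v)$, is a pair $(X,\mathcal{B})$ where $X$ is a set of $v$ points and $\mathcal{B}$ is a set of transitive triples of elements of $X$ such that every ordered pair $(a,b)$ of distinct points of $X$ occurs as a directed edge in exactly one triple of $\mathcal{B}$. A $v$-good sequencing of a DTS$(v)$ $(X,\mathcal{B})$ is a permutation $[x_1\, x_2\, \cdots\, x_v]$ of $X$ such that for no triple $(x,y,z)\in\mathcal{B}$ do we have $x=x_i$, $y=x_j$, $z=x_k$ with $i<j<k$. -}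

module Defs where

open import Level using (Level)
open import Data.Nat using (ℕ)
open import Data.Fin using (Fin; _<_)
open import Data.Product using (_×_; _,_; ∃; ∃-syntax; Σ-syntax)
open import Data.List using (List; length; lookup)
open import Data.List.Membership.Propositional using (_∈_)
open import Data.List.Relation.Unary.Unique.Propositional using (Unique)
open import Data.List.Relation.Binary.Permutation.Propositional using (_↭_)
open import Relation.Binary.PropositionalEquality using (_≡_)
open import Relation.Nullary using (¬_)

private variable ℓ : Level

Triple : Set ℓ → Set ℓ
Triple P = P × P × P

HasEdge : {P : Set ℓ} → Triple P → P → P → Set ℓ
HasEdge (x , y , z) a b = (a ≡ x × b ≡ y) Data.Sum.⊎ ((a ≡ x × b ≡ z) Data.Sum.⊎ (a ≡ y × b ≡ z))
  where import Data.Sum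

TripleIn : {P : Set ℓ} → List P → Triple P → Set ℓ
TripleIn X (x , y , z) = (x ∈ X × y ∈ X × z ∈ X) × (¬ x ≡ y × ¬ x ≡ z × ¬ y ≡ z)

record IsDTS {P : Set ℓ} (v : ℕ) (X : List P) (𝓑 : List (Triple P)) : Set ℓ where
  field
    points-unique : Unique X
    order         : length X ≡ v
    blocks-unique : Unique 𝓑
    blocks-in     : ∀ {t} → t ∈ 𝓑 → TripleIn X t
    covers        : ∀ {a b} → a ∈ X → b ∈ X → ¬ a ≡ b →
                    ∃[ t ] (t ∈ 𝓑 × HasEdge t a b)
    exactly-once  : ∀ {a b t t'} → a ∈ X → b ∈ X → ¬ a ≡ b →
                    t ∈ 𝓑 → HasEdge t a b → t' ∈ 𝓑 → HasEdge t' a b → t ≡ t'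

record IsGoodSequencing {P : Set ℓ} (v : ℕ) (X : List P) (𝓑 : List (Triple P))
                        (s : List P) : Set ℓ where
  field
    perm    : s ↭ X
    length≡ : length s ≡ v
    good    : ∀ {x y z} → (x , y , z) ∈ 𝓑 →
              ¬ (Σ[ i ∈ Fin (length s) ] Σ[ j ∈ Fin (length s) ] Σ[ k ∈ Fin (length s) ]
                   (i < j × j < k × lookup s i ≡ x × lookup s j ≡ y × lookup s k ≡ z))

HasGoodSequencing : {P : Set ℓ} → ℕ → List P → List (Triple P) → Set ℓ
HasGoodSequencing v X 𝓑 = ∃[ s ] IsGoodSequencing v X 𝓑 s

_⊆_ : {A : Set ℓ} → List A → List A → Set ℓ
Y ⊆ X = ∀ {a} → a ∈ Y → a ∈ X

{-# OPTIONS --safe #-}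
-- Listing the points of Y in the order in which they occur in a good sequencing s of X gives
-- a sequencing of Y. A triple of 𝓑 occurring in it in the forbidden order would occur in s in
-- the same order, since its points are distinct; as it is also a triple of 𝓐, this is impossible.
module Submission where

open import Defs
open import Level using (Level)
open import Data.Nat using (ℕ)
import Data.Nat as ℕ
import Data.Nat.Properties as ℕ
open import Data.Fin using (Fin; zero; suc; cast; _≤_; _<_)
open import Data.Fin.Properties using (toℕ-cast; ≤∧≢⇒<; ≤-decTotalOrder)
open import Data.List using (List; _∷_; length; lookup; map)
open import Data.List.Properties using (length-map)
open import Data.List.Membership.Propositional using (mapWith∈)
open import Data.List.Membership.Propositional.Properties using (map-mapWith∈; mapWith∈-cong; mapWith∈-id)
open import Data.List.Relation.Unary.Any using (index)
open import Data.List.Relation.Unary.Any.Properties using (lookup-index)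
open import Data.List.Relation.Unary.Sorted.TotalOrder.Properties using (lookup-mono-≤)
open import Data.List.Relation.Binary.Permutation.Propositional using (_↭_; ↭-sym)
open import Data.List.Relation.Binary.Permutation.Propositional.Properties using (∈-resp-↭; ↭-length; map⁺)
open import Data.Product using (_×_; _,_; Σ-syntax)
open import Relation.Binary.Bundles using (DecTotalOrder)
open import Relation.Binary.PropositionalEquality using (_≡_; _≢_; refl; sym; trans; cong; subst; subst₂; module ≡-Reasoning)
open import Relation.Nullary using (¬_)

private variable
  a ℓ : Level
  A B : Set a
  m n : ℕ

cast-mono-≤ : .(eq : m ≡ n) {i j : Fin m} → i ≤ j → cast eq i ≤ cast eq j
cast-mono-≤ eq {i} {j} = subst₂ ℕ._≤_ (sym (toℕ-cast eq i)) (sym (toℕ-cast eq j))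

lookup-map : (f : A → B) (xs : List A) (i : Fin (length (map f xs))) →
             lookup (map f xs) i ≡ f (lookup xs (cast (length-map f xs) i))
lookup-map f (x ∷ xs) zero    = refl
lookup-map f (x ∷ xs) (suc i) = lookup-map f xs i

map-lookup-index : (s Y : List A) (Y⊆s : Y ⊆ s) →
                   map (lookup s) (mapWith∈ Y (λ p → index (Y⊆s p))) ≡ Y
map-lookup-index s Y Y⊆s = begin
  map (lookup s) (mapWith∈ Y (λ p → index (Y⊆s p)))  ≡⟨ map-mapWith∈ Y _ (lookup s) ⟩
  mapWith∈ Y (λ p → lookup s (index (Y⊆s p)))         ≡⟨ mapWith∈-cong Y _ _ (λ p → sym (lookup-index (Y⊆s p))) ⟩
  mapWith∈ Y (λ {x} _ → x)                             ≡⟨ mapWith∈-id Y ⟩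
  Y                                                    ∎
  where open ≡-Reasoning

-- Distinct entries of t occur in s in the same order; equal entries may be reordered.
record SubsequenceOf {P : Set ℓ} (t s : List P) : Set ℓ where
  field
    position        : Fin (length t) → Fin (length s)
    lookup-position : ∀ i → lookup s (position i) ≡ lookup t i
    position-<      : ∀ {i j} → i < j → lookup t i ≢ lookup t j → position i < position j

module Restriction {P : Set ℓ} (s : List P) where

  open DecTotalOrder (≤-decTotalOrder (length s)) using (totalOrder)
  open import Data.List.Sort (≤-decTotalOrder (length s)) using (sort; sort-↭; sort-↗)

  -- Y is listed by sorting the positions in s of its elements, so no decidable equality on P is needed.
  positions : {Y : List P} → Y ⊆ s → List (Fin (length s))
  positions {Y} Y⊆s = sort (mapWith∈ Y (λ p → index (Y⊆s p)))

  restrict : {Y : List P} → Y ⊆ s → List P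
  restrict Y⊆s = map (lookup s) (positions Y⊆s)

  restrict-↭ : {Y : List P} (Y⊆s : Y ⊆ s) → restrict Y⊆s ↭ Y
  restrict-↭ {Y} Y⊆s =
    subst (restrict Y⊆s ↭_) (map-lookup-index s Y Y⊆s) (map⁺ (lookup s) (sort-↭ _))

  restrict-subsequence : {Y : List P} (Y⊆s : Y ⊆ s) → SubsequenceOf (restrict Y⊆s) s
  restrict-subsequence Y⊆s = record
    { position        = position
    ; lookup-position = λ i → sym (lookup-map (lookup s) (positions Y⊆s) i)
    ; position-<      = position-<
    }
    where
    position : Fin (length (restrict Y⊆s)) → Fin (length s)
    position i = lookup (positions Y⊆s) (cast (length-map (lookup s) (positions Y⊆s)) i)

    position-< : ∀ {i j} → i < j → lookup (restrict Y⊆s) i ≢ lookup (restrict Y⊆s) j →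
                 position i < position j
    position-< {i} {j} i<j ti≢tj = ≤∧≢⇒< position-≤ position-≢
      where
      position-≤ : position i ≤ position j
      position-≤ = lookup-mono-≤ totalOrder (sort-↗ _) (cast-mono-≤ _ (ℕ.<⇒≤ i<j))
      position-≢ : position i ≢ position j
      position-≢ eq = ti≢tj (trans (lookup-map (lookup s) (positions Y⊆s) i)
                             (trans (cong (lookup s) eq) (sym (lookup-map (lookup s) (positions Y⊆s) j))))

OccursIn : {P : Set ℓ} → List P → Triple P → Set ℓ
OccursIn s (x , y , z) =
  Σ[ i ∈ Fin (length s) ] Σ[ j ∈ Fin (length s) ] Σ[ k ∈ Fin (length s) ]
    (i < j × j < k × lookup s i ≡ x × lookup s j ≡ y × lookup s k ≡ z)

occursIn-subsequence : {P : Set ℓ} {t s : List P} {x y z : P} → SubsequenceOf t s →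
                       x ≢ y → y ≢ z → OccursIn t (x , y , z) → OccursIn s (x , y , z)
occursIn-subsequence t⊑s x≢y y≢z (i , j , k , i<j , j<k , refl , refl , refl) =
  position i , position j , position k ,
  position-< i<j x≢y , position-< j<k y≢z ,
  lookup-position i , lookup-position j , lookup-position k
  where open SubsequenceOf t⊑s

lemma5p2 : ∀ {ℓ : Level} {P : Set ℓ} (v w : ℕ) (X Y : List P) (𝓐 𝓑 : List (Triple P)) →
           IsDTS w Y 𝓑 → IsDTS v X 𝓐 → Y ⊆ X → 𝓑 ⊆ 𝓐 →
           ¬ HasGoodSequencing w Y 𝓑 → ¬ HasGoodSequencing v X 𝓐
lemma5p2 v w X Y 𝓐 𝓑 dtsY _ Y⊆X 𝓑⊆𝓐 noGoodY (s , good-s) = noGoodY (restrict Y⊆s , good-t)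
  where
  open IsGoodSequencing good-s using (perm; good)
  open Restriction s

  Y⊆s : Y ⊆ s
  Y⊆s p = ∈-resp-↭ (↭-sym perm) (Y⊆X p)

  good-t : IsGoodSequencing w Y 𝓑 (restrict Y⊆s)
  good-t = record
    { perm    = restrict-↭ Y⊆s
    ; length≡ = trans (↭-length (restrict-↭ Y⊆s)) (IsDTS.order dtsY)
    ; good    = λ t∈𝓑 occurs →
        let (_ , x≢y , _ , y≢z) = IsDTS.blocks-in dtsY t∈𝓑
        in good (𝓑⊆𝓐 t∈𝓑) (occursIn-subsequence (restrict-subsequence Y⊆s) x≢y y≢z occurs)
    }
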